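{- Let $b,c$ be nonzero constants and let $$\tilde\mu(t)=\cfrac{1}{1-ct-\cfrac{bt}{1-ct-\cfrac{bt}{1-ct-\cdots}}}=\frac{1-ct-\sqrt{1-2(2b+c)t+c^2t^2}}{2bt}.$$ Let $\tilde O$ be the Riordan array $$\tilde O=\left(\frac{1+bt}{1+(2b+c)t+b(b+c)t^2},\ \frac{t}{1+(2b+c)t+b(b+c)t^2}\right).$$ Then $\tilde\mu(t)$ is the generating function of the first column of $\tilde O^{ -1}$; that is, $\tilde\mu(t)$ generates the moments of the family of orthogonal polynomials $\tilde Q_n(x)=\sum_k \tilde O_{n,k}x^k$.
   Context: For formal power series $g(t)=g_0+\cdots$ with $g_0\ne0$ and $f(t)=f_1t+\cdots$ with $f_1\ne0$, the Riordan array $(g,f)$ is the lower-triangular matrix with $(n,k)$ entry $[t^n]g(t)f(t)^k$. The polynomials $\tilde Q_n$ satisfy $\tilde Q_0=1$, $\tilde Q_1=x-(b+c)$ and $\tilde Q_n=(x-(2b+c))\tilde Q_{n-1}-b(b+c)\tilde Q_{n-2}$ for $n\ge2$. -}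

module Defs where

open import Level using (_⊔_)
open import Data.Nat using (ℕ; zero; suc; _<_; _∸_)
open import Algebra.Bundles using (CommutativeRing)
open import Relation.Nullary using (¬_)
open import Data.Product using (Σ; _×_)

module RingDefs {a ℓ} (R : CommutativeRing a ℓ) where
  open CommutativeRing R using (Carrier; _≈_; _+_; _*_; -_; 0#; 1#)

  Series : Set a
  Series = ℕ → Carrier

  Matrix : Set a
  Matrix = ℕ → ℕ → Carrier

  sumTo : ℕ → (ℕ → Carrier) → Carrier
  sumTo zero    f = f zero
  sumTo (suc n) f = sumTo n f + f (suc n)

  δ : ℕ → ℕ → Carrier
  δ zero    zero    = 1#
  δ zero    (suc k) = 0#
  δ (suc n) zero    = 0#
  δ (suc n) (suc k) = δ n k

  one : Series
  one = δ 0

  X : Series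
  X = δ 1

  cst : Carrier → Series
  cst r zero    = r
  cst r (suc n) = 0#

  _⊕_ : Series → Series → Series
  (s ⊕ u) n = s n + u n

  _⊛_ : Series → Series → Series
  (s ⊛ u) n = sumTo n (λ i → s i * u (n ∸ i))

  pow : Series → ℕ → Series
  pow s zero    = one
  pow s (suc k) = s ⊛ pow s k

  _≋_ : Series → Series → Set ℓ
  s ≋ u = ∀ n → s n ≈ u n

  -- the power series 1/(1 + α t + β t²): its coefficients h satisfy
  -- h₀ = 1, h₁ = -α, h_{n+2} = -α h_{n+1} - β h_n
  invQuad : Carrier → Carrier → Series
  invQuad α β zero          = 1#
  invQuad α β (suc zero)    = - α
  invQuad α β (suc (suc n)) = - (α * invQuad α β (suc n)) + - (β * invQuad α β n)

  riordan : Series → Series → Matrix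
  riordan g f n k = (g ⊛ pow f k) n

  Otilde : Carrier → Carrier → Matrix
  Otilde b c = riordan ((one ⊕ (cst b ⊛ X)) ⊛ D⁻¹) (X ⊛ D⁻¹)
    where
    D⁻¹ : Series
    D⁻¹ = invQuad ((b + b) + c) (b * (b + c))

  -- lower-triangular matrices and their product (finite sums suffice)
  LowerTriangular : Matrix → Set ℓ
  LowerTriangular A = ∀ n k → n < k → A n k ≈ 0#

  _·_ : Matrix → Matrix → Matrix
  (A · B) n k = sumTo n (λ j → A n j * B j k)

  IsInverse : Matrix → Matrix → Set ℓ
  IsInverse A P = (∀ n k → (A · P) n k ≈ δ n k) × (∀ n k → (P · A) n k ≈ δ n k)

  column₀ : Matrix → Series
  column₀ A n = A n 0

  -- μ̃ is the power series given by the periodic continued fraction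
  --   μ = 1 / (1 - c t - b t μ),
  -- i.e. (multiplying out) μ · (1 - c t - b t μ) = 1.
  IsMuTilde : Carrier → Carrier → Series → Set ℓ
  IsMuTilde b c μ =
    (μ ⊛ ((one ⊕ (cst (- c) ⊛ X)) ⊕ (cst (- b) ⊛ (X ⊛ μ)))) ≋ one

  -- coefficients of Q̃_n(x): Qt b c n k = [x^k] Q̃_n(x)
  shift : Series → Series
  shift p zero    = 0#
  shift p (suc k) = p k

  Qt : Carrier → Carrier → ℕ → Series
  Qt b c zero          = one
  Qt b c (suc zero)    = X ⊕ cst (- (b + c))
  Qt b c (suc (suc n)) =
    (shift (Qt b c (suc n)) ⊕ (cst (- ((b + b) + c)) ⊛ Qt b c (suc n)))
      ⊕ (cst (- (b * (b + c))) ⊛ Qt b c n)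

-- With D = 1 + (2b + c) t + b (b + c) t², the columns of Õ satisfy D Õ₀ = 1 + b t and
-- D Õₖ₊₁ = t Õₖ; read coefficientwise this is the three-term recurrence
-- Q̃ₙ₊₁ = (x - αₙ) Q̃ₙ - β Q̃ₙ₋₁ with α₀ = b + c, αₙ = 2b + c and β = b (b + c),
-- so Õ is the coefficient matrix of the Q̃ₙ. For any such family the array N with
-- production matrix tridiag(1, αₙ, β), whose rows expand xⁿ in the basis Q̃ₖ, is a
-- two-sided inverse of the coefficient matrix, and lower-triangular inverses are unique.
-- Finally let μ be the power series fixed point of μ = 1 + t (c μ + b μ²); then m = μ - 1
-- satisfies m = t (b + c + (2b + c) m + b m²), so the columns μ mᵏ form the array with
-- production matrix tridiag(b + c, αₙ, b). Rescaling column k of N by (b + c)ᵏ gives the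
-- same array, and at k = 0 this identifies the first column of Õ⁻¹ with μ.

module Submission where

open import Defs
open import Algebra.Bundles using (CommutativeRing)
open import Relation.Nullary using (¬_)
open import Data.Product using (Σ; _×_; _,_; proj₁; proj₂)

open import Algebra.Solver.Ring.AlmostCommutativeRing
  using (fromCommutativeRing; _-Raw-AlmostCommutative⟶_)
import Algebra.Properties.Ring as RingProperties
import Algebra.Properties.Monoid.Mult.TCOptimised as MonoidMult
import Algebra.Properties.Semiring.Mult.TCOptimised as SemiringMult
open import Data.Integer.Base as ℤ using (ℤ; +_; -[1+_]; _⊖_)
import Data.Integer.Properties as ℤ
open import Data.Maybe.Base using (Maybe; just; nothing)
open import Data.Nat.Base as ℕ using (ℕ; zero; suc; _∸_; _≤_; _<_; z≤n; s≤s)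
import Data.Nat.Properties as ℕ
open import Data.Nat.GeneralisedArithmetic using (fold)
open import Data.Sum using (inj₁; inj₂)
open import Level using (_⊔_)
open import Relation.Binary.PropositionalEquality.Core as ≡ using (_≡_)
import Relation.Binary.Reasoning.Setoid as SetoidReasoning
open import Relation.Nullary.Decidable.Core using (yes; no)

-- The library's solvers take coefficients in the ring itself, where 1 + (- 1) does not
-- normalise to 0; here the coefficients are integers.
module IntegerRingSolver {a ℓ} (R : CommutativeRing a ℓ) where

  open CommutativeRing R
  open RingProperties ring
    using (-0#≈0#; -‿involutive; -‿+-comm; xyx⁻¹≈y; -‿distribˡ-*; -‿distribʳ-*)
  open MonoidMult +-monoid using (1+×; ×-homo-+) renaming (_×_ to _×′_)
  open SemiringMult semiring using (×1-homo-*)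
  open SetoidReasoning setoid

  ⟦_⟧ℤ : ℤ → Carrier
  ⟦ + n ⟧ℤ      = n ×′ 1#
  ⟦ -[1+ n ] ⟧ℤ = - (suc n ×′ 1#)

  private
    ⟦⟧-≡ : ∀ {i j} → i ≡ j → ⟦ i ⟧ℤ ≈ ⟦ j ⟧ℤ
    ⟦⟧-≡ ≡.refl = refl

    +-cancel-sub : ∀ x y z → (x + y) - (x + z) ≈ y - z
    +-cancel-sub x y z = begin
      (x + y) - (x + z)    ≈⟨ +-congˡ (-‿+-comm x z) ⟨
      (x + y) + (- x - z)  ≈⟨ +-assoc (x + y) (- x) (- z) ⟨
      (x + y) - x - z      ≈⟨ +-congʳ (xyx⁻¹≈y x y) ⟩
      y - z                ∎

    ⟦⟧-neg : ∀ i → ⟦ ℤ.- i ⟧ℤ ≈ - ⟦ i ⟧ℤ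
    ⟦⟧-neg (+ zero)  = sym -0#≈0#
    ⟦⟧-neg (+ suc n) = refl
    ⟦⟧-neg -[1+ n ]  = sym (-‿involutive _)

    ⟦⟧-⊖ : ∀ m n → ⟦ m ⊖ n ⟧ℤ ≈ m ×′ 1# - n ×′ 1#
    ⟦⟧-⊖ m zero = begin
      ⟦ m ⊖ 0 ⟧ℤ     ≈⟨ ⟦⟧-≡ (ℤ.⊖-≥ {m} z≤n) ⟩
      m ×′ 1#         ≈⟨ +-identityʳ _ ⟨
      m ×′ 1# + 0#    ≈⟨ +-congˡ -0#≈0# ⟨
      m ×′ 1# - 0#    ∎
    ⟦⟧-⊖ zero (suc n) = sym (+-identityˡ _)
    ⟦⟧-⊖ (suc m) (suc n) = begin
      ⟦ suc m ⊖ suc n ⟧ℤ                ≈⟨ ⟦⟧-≡ (ℤ.[1+m]⊖[1+n]≡m⊖n m n) ⟩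
      ⟦ m ⊖ n ⟧ℤ                        ≈⟨ ⟦⟧-⊖ m n ⟩
      m ×′ 1# - n ×′ 1#                   ≈⟨ +-cancel-sub 1# _ _ ⟨
      (1# + m ×′ 1#) - (1# + n ×′ 1#)     ≈⟨ +-cong (1+× m 1#) (-‿cong (1+× n 1#)) ⟨
      suc m ×′ 1# - suc n ×′ 1#           ∎

    ⟦⟧-+ : ∀ i j → ⟦ i ℤ.+ j ⟧ℤ ≈ ⟦ i ⟧ℤ + ⟦ j ⟧ℤ
    ⟦⟧-+ (+ m) (+ n)       = ×-homo-+ 1# m n
    ⟦⟧-+ (+ m) -[1+ n ]    = ⟦⟧-⊖ m (suc n)
    ⟦⟧-+ -[1+ m ] (+ n)    = trans (⟦⟧-⊖ n (suc m)) (+-comm _ _)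
    ⟦⟧-+ -[1+ m ] -[1+ n ] = begin
      - (suc (suc (m ℕ.+ n)) ×′ 1#)      ≡⟨ ≡.cong (λ k → - (k ×′ 1#)) (ℕ.+-suc (suc m) n) ⟨
      - ((suc m ℕ.+ suc n) ×′ 1#)        ≈⟨ -‿cong (×-homo-+ 1# (suc m) (suc n)) ⟩
      - (suc m ×′ 1# + suc n ×′ 1#)       ≈⟨ -‿+-comm _ _ ⟨
      - (suc m ×′ 1#) - (suc n ×′ 1#)     ∎

    ⟦⟧-*-ℕ : ∀ m n → ⟦ + m ℤ.* + n ⟧ℤ ≈ m ×′ 1# * n ×′ 1#
    ⟦⟧-*-ℕ m n = trans (⟦⟧-≡ (≡.sym (ℤ.pos-* m n))) (×1-homo-* m n)

    ⟦⟧-*-pos : ∀ m j → ⟦ + m ℤ.* j ⟧ℤ ≈ m ×′ 1# * ⟦ j ⟧ℤ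
    ⟦⟧-*-pos m (+ n)    = ⟦⟧-*-ℕ m n
    ⟦⟧-*-pos m -[1+ n ] = begin
      ⟦ + m ℤ.* -[1+ n ] ⟧ℤ              ≈⟨ ⟦⟧-≡ (ℤ.neg-distribʳ-* (+ m) (+ suc n)) ⟨
      ⟦ ℤ.- (+ m ℤ.* + suc n) ⟧ℤ         ≈⟨ ⟦⟧-neg (+ m ℤ.* + suc n) ⟩
      - ⟦ + m ℤ.* + suc n ⟧ℤ             ≈⟨ -‿cong (⟦⟧-*-ℕ m (suc n)) ⟩
      - (m ×′ 1# * (suc n ×′ 1#))          ≈⟨ -‿distribʳ-* _ _ ⟩
      m ×′ 1# * - (suc n ×′ 1#)            ∎

    ⟦⟧-* : ∀ i j → ⟦ i ℤ.* j ⟧ℤ ≈ ⟦ i ⟧ℤ * ⟦ j ⟧ℤ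
    ⟦⟧-* (+ m) j    = ⟦⟧-*-pos m j
    ⟦⟧-* -[1+ m ] j = begin
      ⟦ -[1+ m ] ℤ.* j ⟧ℤ                ≈⟨ ⟦⟧-≡ (ℤ.neg-distribˡ-* (+ suc m) j) ⟨
      ⟦ ℤ.- (+ suc m ℤ.* j) ⟧ℤ           ≈⟨ ⟦⟧-neg (+ suc m ℤ.* j) ⟩
      - ⟦ + suc m ℤ.* j ⟧ℤ               ≈⟨ -‿cong (⟦⟧-*-pos (suc m) j) ⟩
      - (suc m ×′ 1# * ⟦ j ⟧ℤ)            ≈⟨ -‿distribˡ-* _ _ ⟩
      - (suc m ×′ 1#) * ⟦ j ⟧ℤ            ∎

    ℤ⟶R : ℤ.+-*-rawRing -Raw-AlmostCommutative⟶ fromCommutativeRing R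
    ℤ⟶R = record
      { ⟦_⟧ = ⟦_⟧ℤ ; +-homo = ⟦⟧-+ ; *-homo = ⟦⟧-* ; -‿homo = ⟦⟧-neg
      ; 0-homo = refl ; 1-homo = refl }

    ⟦⟧-≟ : ∀ i j → Maybe (⟦ i ⟧ℤ ≈ ⟦ j ⟧ℤ)
    ⟦⟧-≟ i j with i ℤ.≟ j
    ... | yes i≡j = just (⟦⟧-≡ i≡j)
    ... | no _    = nothing

  open import Algebra.Solver.Ring ℤ.+-*-rawRing (fromCommutativeRing R) ℤ⟶R ⟦⟧-≟ public
    using (solve; _:=_; con; _:+_; _:*_; :-_; _:-_)

module FiniteSums {a ℓ} (R : CommutativeRing a ℓ) where

  open CommutativeRing R
  open RingDefs R using (sumTo)
  open RingProperties ring using (-‿+-comm)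
  open IntegerRingSolver R using (solve; _:=_; _:+_)
  open SetoidReasoning setoid

  sumTo-cong-≤ : ∀ n {f g : ℕ → Carrier} → (∀ i → i ≤ n → f i ≈ g i) →
               sumTo n f ≈ sumTo n g
  sumTo-cong-≤ zero    f≈g = f≈g 0 z≤n
  sumTo-cong-≤ (suc n) f≈g =
    +-cong (sumTo-cong-≤ n (λ i i≤n → f≈g i (ℕ.m≤n⇒m≤1+n i≤n))) (f≈g (suc n) ℕ.≤-refl)

  sumTo-cong : ∀ n {f g : ℕ → Carrier} → (∀ i → f i ≈ g i) → sumTo n f ≈ sumTo n g
  sumTo-cong n f≈g = sumTo-cong-≤ n (λ i _ → f≈g i)

  sumTo-zero : ∀ n {f : ℕ → Carrier} → (∀ i → i ≤ n → f i ≈ 0#) → sumTo n f ≈ 0#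
  sumTo-zero zero    f≈0 = f≈0 0 z≤n
  sumTo-zero (suc n) f≈0 = trans
    (+-cong (sumTo-zero n (λ i i≤n → f≈0 i (ℕ.m≤n⇒m≤1+n i≤n))) (f≈0 (suc n) ℕ.≤-refl))
    (+-identityˡ 0#)

  sumTo-+ : ∀ n (f g : ℕ → Carrier) →
            sumTo n (λ i → f i + g i) ≈ sumTo n f + sumTo n g
  sumTo-+ zero    f g = refl
  sumTo-+ (suc n) f g = trans (+-congʳ (sumTo-+ n f g))
    (solve 4 (λ x y z w → (x :+ y) :+ (z :+ w) := (x :+ z) :+ (y :+ w)) refl _ _ _ _)

  sumTo-neg : ∀ n (f : ℕ → Carrier) → sumTo n (λ i → - f i) ≈ - sumTo n f
  sumTo-neg zero    f = refl
  sumTo-neg (suc n) f = trans (+-congʳ (sumTo-neg n f)) (-‿+-comm _ _)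

  sumTo-*ˡ : ∀ n r (f : ℕ → Carrier) → sumTo n (λ i → r * f i) ≈ r * sumTo n f
  sumTo-*ˡ zero    r f = refl
  sumTo-*ˡ (suc n) r f = trans (+-congʳ (sumTo-*ˡ n r f)) (sym (distribˡ r _ _))

  sumTo-*ʳ : ∀ n r (f : ℕ → Carrier) → sumTo n (λ i → f i * r) ≈ sumTo n f * r
  sumTo-*ʳ zero    r f = refl
  sumTo-*ʳ (suc n) r f = trans (+-congʳ (sumTo-*ʳ n r f)) (sym (distribʳ r _ _))

  sumTo-head : ∀ n (f : ℕ → Carrier) → sumTo (suc n) f ≈ f 0 + sumTo n (λ i → f (suc i))
  sumTo-head zero    f = refl
  sumTo-head (suc n) f = trans (+-congʳ (sumTo-head n f)) (+-assoc _ _ _)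

  sumTo-extend : ∀ {n} m (f : ℕ → Carrier) → n ≤ m → (∀ i → n < i → f i ≈ 0#) →
                 sumTo m f ≈ sumTo n f
  sumTo-extend m f n≤m f≈0 with ℕ.m≤n⇒m<n∨m≡n n≤m
  sumTo-extend m       f _ f≈0 | inj₂ ≡.refl     = refl
  sumTo-extend (suc m) f _ f≈0 | inj₁ (s≤s n≤m) =
    trans (+-cong (sumTo-extend m f n≤m f≈0) (f≈0 (suc m) (s≤s n≤m))) (+-identityʳ _)

  sumTo-reverse : ∀ n (f : ℕ → Carrier) → sumTo n f ≈ sumTo n (λ i → f (n ∸ i))
  sumTo-reverse zero    f = refl
  sumTo-reverse (suc n) f = begin
    sumTo n f + f (suc n)                     ≈⟨ +-congʳ (sumTo-reverse n f) ⟩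
    sumTo n (λ i → f (n ∸ i)) + f (suc n)     ≈⟨ +-comm _ _ ⟩
    f (suc n) + sumTo n (λ i → f (n ∸ i))     ≈⟨ sumTo-head n (λ i → f (suc n ∸ i)) ⟨
    sumTo (suc n) (λ i → f (suc n ∸ i))       ∎

  sumTo-swap : ∀ n m (F : ℕ → ℕ → Carrier) →
    sumTo n (λ i → sumTo m (F i)) ≈ sumTo m (λ j → sumTo n (λ i → F i j))
  sumTo-swap zero    m F = refl
  sumTo-swap (suc n) m F = trans (+-congʳ (sumTo-swap n m F)) (sym (sumTo-+ m _ _))

module PowerSeries {a ℓ} (R : CommutativeRing a ℓ) where

  open CommutativeRing R
  open RingDefs R
  open FiniteSums R
  open IntegerRingSolver R using (solve; _:=_; _:+_; _:*_)
  open RingProperties ring using (-0#≈0#)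
  open SetoidReasoning setoid

  0s : Series
  0s _ = 0#

  neg : Series → Series
  neg s n = - s n

  tail : Series → Series
  tail s n = s (suc n)

  scale : Carrier → Series → Series
  scale r s n = r * s n

  ⊛-cong : ∀ {s s′ u u′} → s ≋ s′ → u ≋ u′ → (s ⊛ u) ≋ (s′ ⊛ u′)
  ⊛-cong s≋s′ u≋u′ n = sumTo-cong n (λ i → *-cong (s≋s′ i) (u≋u′ (n ∸ i)))

  ⊛-congˡ : ∀ {s s′} u → s ≋ s′ → (s ⊛ u) ≋ (s′ ⊛ u)
  ⊛-congˡ u s≋s′ = ⊛-cong {u = u} s≋s′ (λ _ → refl)

  ⊛-congʳ : ∀ s {u u′} → u ≋ u′ → (s ⊛ u) ≋ (s ⊛ u′)
  ⊛-congʳ s u≋u′ = ⊛-cong {s = s} (λ _ → refl) u≋u′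

  ⊕-congˡ : ∀ s {u u′} → u ≋ u′ → (s ⊕ u) ≋ (s ⊕ u′)
  ⊕-congˡ s u≋u′ n = +-congˡ (u≋u′ n)

  ⊕-congʳ : ∀ {s s′} u → s ≋ s′ → (s ⊕ u) ≋ (s′ ⊕ u)
  ⊕-congʳ u s≋s′ n = +-congʳ (s≋s′ n)

  ⊛-suc : ∀ s u n → (s ⊛ u) (suc n) ≈ s 0 * u (suc n) + (tail s ⊛ u) n
  ⊛-suc s u n = sumTo-head n (λ i → s i * u (suc n ∸ i))

  ⊛-comm : ∀ s u → (s ⊛ u) ≋ (u ⊛ s)
  ⊛-comm s u n = trans (sumTo-reverse n _) (sumTo-cong-≤ n (λ i i≤n →
    trans (*-comm _ _) (*-congʳ (reflexive (≡.cong u (ℕ.m∸[m∸n]≡n i≤n))))))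

  ⊛-distribʳ : ∀ s s′ u → ((s ⊕ s′) ⊛ u) ≋ ((s ⊛ u) ⊕ (s′ ⊛ u))
  ⊛-distribʳ s s′ u n = trans (sumTo-cong n (λ i → distribʳ _ _ _)) (sumTo-+ n _ _)

  ⊛-zeroˡ : ∀ {z} u → z ≋ 0s → (z ⊛ u) ≋ 0s
  ⊛-zeroˡ u z≋0 n = sumTo-zero n (λ i _ → trans (*-congʳ (z≋0 i)) (zeroˡ _))

  ⊛-identityˡ : ∀ s → (one ⊛ s) ≋ s
  ⊛-identityˡ s zero    = *-identityˡ _
  ⊛-identityˡ s (suc n) = trans (⊛-suc one s n)
    (trans (+-cong (*-identityˡ _) (⊛-zeroˡ s (λ _ → refl) n)) (+-identityʳ _))

  ⊛-scaleˡ : ∀ r s u → (scale r s ⊛ u) ≋ scale r (s ⊛ u)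
  ⊛-scaleˡ r s u n = trans (sumTo-cong n (λ i → *-assoc _ _ _)) (sumTo-*ˡ n r _)

  ⊛-assoc : ∀ s u v → ((s ⊛ u) ⊛ v) ≋ (s ⊛ (u ⊛ v))
  ⊛-assoc s u v zero    = *-assoc _ _ _
  ⊛-assoc s u v (suc n) = begin
    ((s ⊛ u) ⊛ v) (suc n)
      ≈⟨ ⊛-suc (s ⊛ u) v n ⟩
    (s 0 * u 0) * v (suc n) + (tail (s ⊛ u) ⊛ v) n
      ≈⟨ +-congˡ (⊛-cong {u = v} (⊛-suc s u) (λ _ → refl) n) ⟩
    (s 0 * u 0) * v (suc n) + ((scale (s 0) (tail u) ⊕ (tail s ⊛ u)) ⊛ v) n
      ≈⟨ +-congˡ (trans (⊛-distribʳ _ _ v n)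
                        (+-cong (⊛-scaleˡ (s 0) (tail u) v n) (⊛-assoc (tail s) u v n))) ⟩
    (s 0 * u 0) * v (suc n) + (s 0 * (tail u ⊛ v) n + (tail s ⊛ (u ⊛ v)) n)
      ≈⟨ solve 5 (λ x y z w t → (x :* y) :* z :+ (x :* w :+ t) := x :* (y :* z :+ w) :+ t)
               refl (s 0) (u 0) (v (suc n)) ((tail u ⊛ v) n) ((tail s ⊛ (u ⊛ v)) n) ⟩
    s 0 * (u 0 * v (suc n) + (tail u ⊛ v) n) + (tail s ⊛ (u ⊛ v)) n
      ≈⟨ +-congʳ (*-congˡ (⊛-suc u v n)) ⟨
    s 0 * (u ⊛ v) (suc n) + (tail s ⊛ (u ⊛ v)) n
      ≈⟨ ⊛-suc s (u ⊛ v) n ⟨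
    (s ⊛ (u ⊛ v)) (suc n) ∎

  SeriesRing : CommutativeRing a ℓ
  SeriesRing = record
    { Carrier = Series ; _≈_ = _≋_ ; _+_ = _⊕_ ; _*_ = _⊛_ ; -_ = neg ; 0# = 0s ; 1# = one
    ; isCommutativeRing = record
      { isRing = record
        { +-isAbelianGroup = record
          { isGroup = record
            { isMonoid = record
              { isSemigroup = record
                { isMagma = record
                  { isEquivalence = record
                    { refl = λ _ → refl ; sym = λ p n → sym (p n) ; trans = λ p q n → trans (p n) (q n) }
                  ; ∙-cong = λ p q n → +-cong (p n) (q n) }
                ; assoc = λ _ _ _ _ → +-assoc _ _ _ }
              ; identity = (λ _ _ → +-identityˡ _) , (λ _ _ → +-identityʳ _) }
            ; inverse = (λ _ _ → -‿inverseˡ _) , (λ _ _ → -‿inverseʳ _)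
            ; ⁻¹-cong = λ p n → -‿cong (p n) }
          ; comm = λ _ _ _ → +-comm _ _ }
        ; *-cong = ⊛-cong
        ; *-assoc = ⊛-assoc
        ; *-identity = ⊛-identityˡ , (λ s n → trans (⊛-comm s one n) (⊛-identityˡ s n))
        ; distrib = (λ s u v n → trans (⊛-comm s (u ⊕ v) n)
                        (trans (⊛-distribʳ u v s n) (+-cong (⊛-comm u s n) (⊛-comm v s n))))
                  , (λ s u v → ⊛-distribʳ u v s) }
      ; *-comm = ⊛-comm } }

  cst-⊛ : ∀ r s n → (cst r ⊛ s) n ≈ r * s n
  cst-⊛ r s zero    = refl
  cst-⊛ r s (suc n) = trans (⊛-suc (cst r) s n)
    (trans (+-congˡ (⊛-zeroˡ s (λ _ → refl) n)) (+-identityʳ _))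

  cst-+ : ∀ x y → cst (x + y) ≋ (cst x ⊕ cst y)
  cst-+ x y zero    = refl
  cst-+ x y (suc n) = sym (+-identityˡ 0#)

  cst-neg : ∀ x → cst (- x) ≋ neg (cst x)
  cst-neg x zero    = refl
  cst-neg x (suc n) = sym -0#≈0#

  shift-cong : ∀ {u v} → u ≋ v → shift u ≋ shift v
  shift-cong u≋v zero    = refl
  shift-cong u≋v (suc n) = u≋v n

  X-⊛ : ∀ s → (X ⊛ s) ≋ shift s
  X-⊛ s zero    = zeroˡ _
  X-⊛ s (suc n) = trans (⊛-suc X s n) (trans (+-cong (zeroˡ _) (⊛-identityˡ s n)) (+-identityˡ _))

  _≈[<_]_ : Series → ℕ → Series → Set ℓ
  u ≈[< n ] v = ∀ i → i < n → u i ≈ v i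

  ⊕-cong-< : ∀ {n s s′ u u′} → s ≈[< n ] s′ → u ≈[< n ] u′ → (s ⊕ u) ≈[< n ] (s′ ⊕ u′)
  ⊕-cong-< s≈s′ u≈u′ i i<n = +-cong (s≈s′ i i<n) (u≈u′ i i<n)

  ⊛-cong-< : ∀ {n s s′ u u′} → s ≈[< n ] s′ → u ≈[< n ] u′ → (s ⊛ u) ≈[< n ] (s′ ⊛ u′)
  ⊛-cong-< s≈s′ u≈u′ i i<n = sumTo-cong-≤ i (λ j j≤i →
    *-cong (s≈s′ j (ℕ.≤-<-trans j≤i i<n)) (u≈u′ (i ∸ j) (ℕ.≤-<-trans (ℕ.m∸n≤m i j) i<n)))

  X-⊛-cong-< : ∀ {n u v} → u ≈[< n ] v → (X ⊛ u) ≈[< suc n ] (X ⊛ v)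
  X-⊛-cong-< {u = u} {v} u≈v zero    _         = trans (X-⊛ u 0) (sym (X-⊛ v 0))
  X-⊛-cong-< {u = u} {v} u≈v (suc i) (s≤s i<n) =
    trans (X-⊛ u (suc i)) (trans (u≈v i i<n) (sym (X-⊛ v (suc i))))

  IsContraction : (Series → Series) → Set (a ⊔ ℓ)
  IsContraction Φ = ∀ {n u v} → u ≈[< n ] v → Φ u ≈[< suc n ] Φ v

  module FixedPoint (Φ : Series → Series) (contraction : IsContraction Φ) where

    iterates-agree : ∀ n → fold 0s Φ n ≈[< n ] fold 0s Φ (suc n)
    iterates-agree zero    _ ()
    iterates-agree (suc n) = contraction (iterates-agree n)

    -- The n-th coefficient is frozen from the (n+1)-st iterate on.
    fixedPoint : Series
    fixedPoint n = fold 0s Φ (suc n) n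

    fixedPoint-≈-iterate : ∀ n → fixedPoint ≈[< n ] fold 0s Φ n
    fixedPoint-≈-iterate zero    _ ()
    fixedPoint-≈-iterate (suc n) i (s≤s i≤n) with ℕ.m≤n⇒m<n∨m≡n i≤n
    ... | inj₁ i<n    = trans (fixedPoint-≈-iterate n i i<n) (iterates-agree n i i<n)
    ... | inj₂ ≡.refl = refl

    fixedPoint-fixed : Φ fixedPoint ≋ fixedPoint
    fixedPoint-fixed n = contraction (fixedPoint-≈-iterate n) n ℕ.≤-refl

module LowerTriangularMatrices {a ℓ} (R : CommutativeRing a ℓ) where

  open CommutativeRing R
  open RingDefs R
  open FiniteSums R
  open SetoidReasoning setoid

  column : Matrix → ℕ → Series
  column A k n = A n k

  previous : Matrix → Matrix
  previous A zero    _ = 0#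
  previous A (suc n)   = A n

  shift-column : ∀ A k n → shift (column A k) n ≡ previous A n k
  shift-column A k zero    = ≡.refl
  shift-column A k (suc n) = ≡.refl

  δ-diagonal : ∀ n → δ n n ≈ 1#
  δ-diagonal zero    = refl
  δ-diagonal (suc n) = δ-diagonal n

  δ-above : ∀ {m n} → m < n → δ m n ≈ 0#
  δ-above {zero}  {suc n} _         = refl
  δ-above {suc m} {suc n} (s≤s m<n) = δ-above m<n

  δ-below : ∀ {m n} → n < m → δ m n ≈ 0#
  δ-below {suc m} {zero}  _         = refl
  δ-below {suc m} {suc n} (s≤s n<m) = δ-below n<m

  δ-sift : ∀ m n (f : ℕ → Carrier) → f n * δ m n ≈ f m * δ m n
  δ-sift zero    zero    f = refl
  δ-sift zero    (suc n) f = trans (zeroʳ _) (sym (zeroʳ _))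
  δ-sift (suc m) zero    f = trans (zeroʳ _) (sym (zeroʳ _))
  δ-sift (suc m) (suc n) f = δ-sift m n (λ i → f (suc i))

  sumTo-δˡ : ∀ n (f : ℕ → Carrier) → sumTo n (λ j → δ n j * f j) ≈ f n
  sumTo-δˡ zero    f = *-identityˡ _
  sumTo-δˡ (suc n) f = begin
    sumTo n (λ j → δ (suc n) j * f j) + δ n n * f (suc n)
      ≈⟨ +-cong (sumTo-zero n (λ j j≤n → trans (*-congʳ (δ-below (s≤s j≤n))) (zeroˡ _)))
                (trans (*-congʳ (δ-diagonal n)) (*-identityˡ _)) ⟩
    0# + f (suc n)
      ≈⟨ +-identityˡ _ ⟩
    f (suc n) ∎

  sumTo-δʳ : ∀ n k (f : ℕ → Carrier) → k ≤ n → sumTo n (λ j → f j * δ j k) ≈ f k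
  sumTo-δʳ zero    zero f _ = *-identityʳ _
  sumTo-δʳ (suc n) k    f k≤1+n with ℕ.m≤n⇒m<n∨m≡n k≤1+n
  ... | inj₁ (s≤s k≤n) = trans
    (+-cong (sumTo-δʳ n k f k≤n) (trans (*-congˡ (δ-below (s≤s k≤n))) (zeroʳ _)))
    (+-identityʳ _)
  ... | inj₂ ≡.refl    = trans
    (+-cong (sumTo-zero n (λ j j≤n → trans (*-congˡ (δ-above (s≤s j≤n))) (zeroʳ _)))
            (trans (*-congˡ (δ-diagonal n)) (*-identityʳ _)))
    (+-identityˡ _)

  ·-cong : ∀ {A A′ B B′ : Matrix} → (∀ n k → A n k ≈ A′ n k) → (∀ n k → B n k ≈ B′ n k) →
           ∀ n k → (A · B) n k ≈ (A′ · B′) n k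
  ·-cong A≈A′ B≈B′ n k = sumTo-cong n (λ j → *-cong (A≈A′ n j) (B≈B′ j k))

  ·-congˡ : ∀ {A A′ : Matrix} (B : Matrix) → (∀ n k → A n k ≈ A′ n k) →
            ∀ n k → (A · B) n k ≈ (A′ · B) n k
  ·-congˡ B A≈A′ = ·-cong A≈A′ (λ _ _ → refl)

  ·-congʳ : ∀ (A : Matrix) {B B′ : Matrix} → (∀ n k → B n k ≈ B′ n k) →
            ∀ n k → (A · B) n k ≈ (A · B′) n k
  ·-congʳ A B≈B′ = ·-cong (λ _ _ → refl) B≈B′

  ·-identityˡ : ∀ (A : Matrix) n k → (δ · A) n k ≈ A n k
  ·-identityˡ A n k = sumTo-δˡ n (λ j → A j k)

  ·-identityʳ : ∀ {A : Matrix} → LowerTriangular A → ∀ n k → (A · δ) n k ≈ A n k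
  ·-identityʳ {A} lower n k with ℕ.≤-<-connex k n
  ... | inj₁ k≤n = sumTo-δʳ n k (A n) k≤n
  ... | inj₂ n<k = trans
    (sumTo-zero n (λ j j≤n → trans (*-congˡ (δ-above (ℕ.≤-<-trans j≤n n<k))) (zeroʳ _)))
    (sym (lower n k n<k))

  -- (B · C) i k sums over j ≤ i only; it extends to j ≤ n since B is lower triangular.
  ·-assoc : ∀ (A B C : Matrix) → LowerTriangular B → ∀ n k → ((A · B) · C) n k ≈ (A · (B · C)) n k
  ·-assoc A B C lower n k = begin
    sumTo n (λ j → sumTo n (λ i → A n i * B i j) * C j k)
      ≈⟨ sumTo-cong n (λ j → sym (sumTo-*ʳ n (C j k) (λ i → A n i * B i j))) ⟩
    sumTo n (λ j → sumTo n (λ i → (A n i * B i j) * C j k))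
      ≈⟨ sumTo-swap n n (λ i j → (A n i * B i j) * C j k) ⟨
    sumTo n (λ i → sumTo n (λ j → (A n i * B i j) * C j k))
      ≈⟨ sumTo-cong n (λ i → trans (sumTo-cong n (λ j → *-assoc _ _ _))
                                    (sumTo-*ˡ n (A n i) (λ j → B i j * C j k))) ⟩
    sumTo n (λ i → A n i * sumTo n (λ j → B i j * C j k))
      ≈⟨ sumTo-cong-≤ n (λ i i≤n → *-congˡ (sumTo-extend n (λ j → B i j * C j k) i≤n
                                   (λ j i<j → trans (*-congʳ (lower i j i<j)) (zeroˡ _)))) ⟩
    sumTo n (λ i → A n i * sumTo i (λ j → B i j * C j k)) ∎

  inverse-unique : ∀ {A N P : Matrix} → LowerTriangular A → LowerTriangular N →
                   IsInverse A N → IsInverse A P → ∀ n k → P n k ≈ N n k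
  inverse-unique {A} {N} {P} lowerA lowerN (_ , NA≈δ) (AP≈δ , _) n k = begin
    P n k               ≈⟨ ·-identityˡ P n k ⟨
    (δ · P) n k         ≈⟨ ·-congˡ P (λ n k → sym (NA≈δ n k)) n k ⟩
    ((N · A) · P) n k   ≈⟨ ·-assoc N A P lowerA n k ⟩
    (N · (A · P)) n k   ≈⟨ ·-congʳ N AP≈δ n k ⟩
    (N · δ) n k         ≈⟨ ·-identityʳ lowerN n k ⟩
    N n k               ∎

module ProductionMatrices {a ℓ} (R : CommutativeRing a ℓ)
  (sup diag sub : ℕ → CommutativeRing.Carrier R) where

  open CommutativeRing R
  open RingDefs R
  open FiniteSums R
  open PowerSeries R using (shift-cong)
  open LowerTriangularMatrices R using (δ-above)
  open IntegerRingSolver R using (solve; _:=_; con; _:+_; _:*_)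
  open SetoidReasoning setoid

  -- Row vector times the tridiagonal matrix whose column k has entries sup k, diag k, sub k
  -- in rows k - 1, k, k + 1 (so sup 0 is unused).
  rowStep : Series → Series
  rowStep r k = sup k * shift r k + (diag k * r k + sub k * r (suc k))

  -- The same matrix times a column vector.
  columnStep : Series → Series
  columnStep c k = sup (suc k) * c (suc k) + (diag k * c k + shift (λ i → sub i * c i) k)

  productionArray : Matrix
  productionArray zero    = δ 0
  productionArray (suc n) = rowStep (productionArray n)

  rowStep-cong : ∀ {r r′} → r ≋ r′ → rowStep r ≋ rowStep r′
  rowStep-cong r≋r′ k =
    +-cong (*-congˡ (shift-cong r≋r′ k)) (+-cong (*-congˡ (r≋r′ k)) (*-congˡ (r≋r′ (suc k))))

  productionArray-unique : ∀ {A : Matrix} → A 0 ≋ δ 0 → (∀ n → A (suc n) ≋ rowStep (A n)) →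
                           ∀ n k → A n k ≈ productionArray n k
  productionArray-unique A₀ A₊ zero    = A₀
  productionArray-unique A₀ A₊ (suc n) k =
    trans (A₊ n k) (rowStep-cong (productionArray-unique A₀ A₊ n) k)

  productionArray-lowerTriangular : LowerTriangular productionArray
  productionArray-lowerTriangular zero    k       0<k       = δ-above 0<k
  productionArray-lowerTriangular (suc n) (suc k) (s≤s n<k) = begin
    sup (suc k) * A n k + (diag (suc k) * A n (suc k) + sub (suc k) * A n (suc (suc k)))
      ≈⟨ +-cong (*-congˡ (productionArray-lowerTriangular n k n<k))
                (+-cong (*-congˡ (productionArray-lowerTriangular n (suc k) (ℕ.m<n⇒m<1+n n<k)))
                        (*-congˡ (productionArray-lowerTriangular n (suc (suc k))
                                    (ℕ.m<n⇒m<1+n (ℕ.m<n⇒m<1+n n<k))))) ⟩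
    sup (suc k) * 0# + (diag (suc k) * 0# + sub (suc k) * 0#)
      ≈⟨ solve 3 (λ x y z → x :* con (+ 0) :+ (y :* con (+ 0) :+ z :* con (+ 0)) := con (+ 0)) refl _ _ _ ⟩
    0# ∎
    where A = productionArray

  -- The transposition identity ⟨r P, c⟩ = ⟨r, P c⟩ for a row r supported on [0, n].
  sumTo-rowStep-transpose : ∀ n (r c : ℕ → Carrier) → (∀ k → n < k → r k ≈ 0#) →
    sumTo (suc n) (λ k → rowStep r k * c k) ≈ sumTo n (λ k → r k * columnStep c k)
  sumTo-rowStep-transpose n r c r≈0 = begin
    sumTo (suc n) (λ k → rowStep r k * c k)
      ≈⟨ sumTo-cong (suc n) (λ k → solve 7
           (λ l s d x u y z → (l :* s :+ (d :* x :+ u :* y)) :* z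
                           := s :* (l :* z) :+ (x :* (d :* z) :+ y :* (u :* z)))
           refl (sup k) (shift r k) (diag k) (r k) (sub k) (r (suc k)) (c k)) ⟩
    sumTo (suc n) (λ k → shift r k * (sup k * c k) + (r k * (diag k * c k) + r (suc k) * (sub k * c k)))
      ≈⟨ trans (sumTo-+ (suc n) _ _) (+-congˡ (sumTo-+ (suc n) _ _)) ⟩
    sumTo (suc n) (λ k → shift r k * (sup k * c k))
      + (sumTo (suc n) (λ k → r k * (diag k * c k)) + sumTo (suc n) (λ k → r (suc k) * (sub k * c k)))
      ≈⟨ +-cong lower (+-cong diagonal upper) ⟩
    sumTo n (λ k → r k * (sup (suc k) * c (suc k)))
      + (sumTo n (λ k → r k * (diag k * c k)) + sumTo n (λ k → r k * shift (λ i → sub i * c i) k))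
      ≈⟨ trans (sumTo-+ n _ _) (+-congˡ (sumTo-+ n _ _)) ⟨
    sumTo n (λ k → r k * (sup (suc k) * c (suc k))
                   + (r k * (diag k * c k) + r k * shift (λ i → sub i * c i) k))
      ≈⟨ sumTo-cong n (λ k → trans (+-congˡ (sym (distribˡ _ _ _))) (sym (distribˡ _ _ _))) ⟩
    sumTo n (λ k → r k * columnStep c k) ∎
    where
    vanishes : ∀ {h : ℕ → Carrier} k → n < k → r k * h k ≈ 0#
    vanishes k n<k = trans (*-congʳ (r≈0 k n<k)) (zeroˡ _)

    lower : sumTo (suc n) (λ k → shift r k * (sup k * c k)) ≈ sumTo n (λ k → r k * (sup (suc k) * c (suc k)))
    lower = trans (sumTo-head n _) (trans (+-congʳ (zeroˡ _)) (+-identityˡ _))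

    diagonal : sumTo (suc n) (λ k → r k * (diag k * c k)) ≈ sumTo n (λ k → r k * (diag k * c k))
    diagonal = sumTo-extend (suc n) _ (ℕ.n≤1+n n) vanishes

    upper : sumTo (suc n) (λ k → r (suc k) * (sub k * c k))
            ≈ sumTo n (λ k → r k * shift (λ i → sub i * c i) k)
    upper = begin
      sumTo (suc n) (λ k → r (suc k) * (sub k * c k))
        ≈⟨ trans (+-congʳ (zeroʳ _)) (+-identityˡ _) ⟨
      r 0 * 0# + sumTo (suc n) (λ k → r (suc k) * (sub k * c k))
        ≈⟨ sumTo-head (suc n) _ ⟨
      sumTo (suc (suc n)) (λ k → r k * shift (λ i → sub i * c i) k)
        ≈⟨ sumTo-extend (suc (suc n)) _ (ℕ.m≤n⇒m≤1+n (ℕ.n≤1+n n)) vanishes ⟩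
      sumTo n (λ k → r k * shift (λ i → sub i * c i) k) ∎

  sumTo-rowStep-linear : ∀ n (q : ℕ → Carrier) (M : Matrix) k →
    sumTo n (λ j → q j * rowStep (M j) k) ≈ rowStep (λ i → sumTo n (λ j → q j * M j i)) k
  sumTo-rowStep-linear n q M k = begin
    sumTo n (λ j → q j * rowStep (M j) k)
      ≈⟨ sumTo-cong n (λ j → solve 7
           (λ q l s d x u y → q :* (l :* s :+ (d :* x :+ u :* y))
                           := l :* (q :* s) :+ (d :* (q :* x) :+ u :* (q :* y)))
           refl (q j) (sup k) (shift (M j) k) (diag k) (M j k) (sub k) (M j (suc k))) ⟩
    sumTo n (λ j → sup k * (q j * shift (M j) k) + (diag k * (q j * M j k) + sub k * (q j * M j (suc k))))
      ≈⟨ trans (sumTo-+ n _ _) (+-cong (sumTo-*ˡ n (sup k) _)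
           (trans (sumTo-+ n _ _) (+-cong (sumTo-*ˡ n (diag k) _) (sumTo-*ˡ n (sub k) _)))) ⟩
    sup k * sumTo n (λ j → q j * shift (M j) k)
      + (diag k * sumTo n (λ j → q j * M j k) + sub k * sumTo n (λ j → q j * M j (suc k)))
      ≈⟨ +-congʳ (*-congˡ (sumTo-shift k)) ⟩
    rowStep (λ i → sumTo n (λ j → q j * M j i)) k ∎
    where
    sumTo-shift : ∀ k → sumTo n (λ j → q j * shift (M j) k)
                        ≈ shift (λ i → sumTo n (λ j → q j * M j i)) k
    sumTo-shift zero    = sumTo-zero n (λ j _ → zeroʳ (q j))
    sumTo-shift (suc k) = refl

module ThreeTermRecurrences {a ℓ} (R : CommutativeRing a ℓ)
  (α β : ℕ → CommutativeRing.Carrier R) where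

  open CommutativeRing R
  open RingDefs R
  open FiniteSums R
  open PowerSeries R using (shift-cong)
  open LowerTriangularMatrices R
  open ProductionMatrices R (λ _ → 1#) α (λ k → β (suc k))
  open IntegerRingSolver R using (solve; _:=_; con; _:+_; _:*_; _:-_)
  open SetoidReasoning setoid

  -- Q n k is the coefficient of xᵏ in Qₙ, where Q₀ = 1 and Qₙ₊₁ = (x - α n) Qₙ - β n Qₙ₋₁.
  record IsThreeTermFamily (Q : Matrix) : Set ℓ where
    field
      zeroth : Q 0 ≋ δ 0
      next   : ∀ n k → Q (suc n) k ≈ shift (Q n) k - α n * Q n k - β n * previous Q n k

  -- xⁿ = Σₖ moments n k · Qₖ: multiplying by x and applying the recurrence gives the next row.
  moments : Matrix
  moments = productionArray

  family-unique : ∀ {P Q} → IsThreeTermFamily P → IsThreeTermFamily Q → ∀ n k → P n k ≈ Q n k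
  family-unique {P} {Q} P-family Q-family n = proj₁ (agree n)
    where
    module P = IsThreeTermFamily P-family
    module Q = IsThreeTermFamily Q-family
    agree : ∀ n → P n ≋ Q n × previous P n ≋ previous Q n
    agree zero    = (λ k → trans (P.zeroth k) (sym (Q.zeroth k))) , (λ _ → refl)
    agree (suc n) = (λ k → trans (P.next n k) (trans (step k) (sym (Q.next n k)))) , Pₙ≋Qₙ
      where
      Pₙ≋Qₙ = proj₁ (agree n)
      step : ∀ k → shift (P n) k - α n * P n k - β n * previous P n k
                 ≈ shift (Q n) k - α n * Q n k - β n * previous Q n k
      step k = +-cong (+-cong (shift-cong Pₙ≋Qₙ k) (-‿cong (*-congˡ (Pₙ≋Qₙ k))))
                      (-‿cong (*-congˡ (proj₂ (agree n) k)))

  moments-lowerTriangular : LowerTriangular moments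
  moments-lowerTriangular = productionArray-lowerTriangular

  -- δ satisfies the recurrence of family·moments-step, which closes the induction there.
  δ-step : ∀ n k → rowStep (δ n) k - α n * δ n k - β n * previous δ n k
                   ≈ δ (suc n) k
  δ-step n k = begin
    1# * shift (δ n) k + (α k * δ n k + β (suc k) * δ n (suc k)) - α n * δ n k - β n * previous δ n k
      ≈⟨ +-congʳ (+-congʳ (+-cong (*-congˡ (shift-δ k)) (+-cong (δ-sift n k α) (upper n k)))) ⟩
    1# * δ (suc n) k + (α n * δ n k + β n * previous δ n k) - α n * δ n k - β n * previous δ n k
      ≈⟨ solve 5 (λ d a x b y → con (+ 1) :* d :+ (a :* x :+ b :* y) :- a :* x :- b :* y := d)
               refl (δ (suc n) k) (α n) (δ n k) (β n) (previous δ n k) ⟩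
    δ (suc n) k ∎
    where
    shift-δ : ∀ k → shift (δ n) k ≈ δ (suc n) k
    shift-δ zero    = refl
    shift-δ (suc k) = refl
    upper : ∀ n k → β (suc k) * δ n (suc k) ≈ β n * previous δ n k
    upper zero    k = trans (zeroʳ _) (sym (zeroʳ _))
    upper (suc n) k = δ-sift n k (λ i → β (suc i))

  module _ {Q : Matrix} (Q-family : IsThreeTermFamily Q) where

    open IsThreeTermFamily Q-family

    x·Q : ∀ n k → shift (Q n) k ≈ Q (suc n) k + (α n * Q n k + β n * previous Q n k)
    x·Q n k = begin
      shift (Q n) k
        ≈⟨ solve 5 (λ s a q b p → s := (s :- a :* q :- b :* p) :+ (a :* q :+ b :* p))
                 refl (shift (Q n) k) (α n) (Q n k) (β n) (previous Q n k) ⟩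
      (shift (Q n) k - α n * Q n k - β n * previous Q n k) + (α n * Q n k + β n * previous Q n k)
        ≈⟨ +-congʳ (next n k) ⟨
      Q (suc n) k + (α n * Q n k + β n * previous Q n k) ∎

    family-lowerTriangular : LowerTriangular Q
    family-lowerTriangular n k = proj₁ (vanish n) k
      where
      vanish : ∀ n → (∀ k → n < k → Q n k ≈ 0#) × (∀ k → n < k → previous Q n k ≈ 0#)
      vanish zero    = (λ k 0<k → trans (zeroth k) (δ-above 0<k)) , (λ _ _ → refl)
      vanish (suc n) = Qₙ₊₁≈0 , (λ k 1+n<k → Qₙ≈0 k (ℕ.<-trans (ℕ.n<1+n n) 1+n<k))
        where
        Qₙ≈0 = proj₁ (vanish n)
        Qₙ₊₁≈0 : ∀ k → suc n < k → Q (suc n) k ≈ 0#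
        Qₙ₊₁≈0 (suc k) (s≤s n<k) = begin
          Q (suc n) (suc k)
            ≈⟨ next n (suc k) ⟩
          Q n k - α n * Q n (suc k) - β n * previous Q n (suc k)
            ≈⟨ +-cong (+-cong (Qₙ≈0 k n<k) (-‿cong (*-congˡ (Qₙ≈0 (suc k) (ℕ.m<n⇒m<1+n n<k)))))
                      (-‿cong (*-congˡ (proj₂ (vanish n) (suc k) (ℕ.m<n⇒m<1+n n<k)))) ⟩
          0# - α n * 0# - β n * 0#
            ≈⟨ solve 2 (λ a b → con (+ 0) :- a :* con (+ 0) :- b :* con (+ 0) := con (+ 0))
                     refl (α n) (β n) ⟩
          0# ∎

    moments·family : ∀ n k → (moments · Q) n k ≈ δ n k
    moments·family zero    k = trans (*-identityˡ _) (zeroth k)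
    moments·family (suc n) k = begin
      sumTo (suc n) (λ j → moments (suc n) j * Q j k)
        ≈⟨ sumTo-rowStep-transpose n (moments n) (λ j → Q j k)
             (moments-lowerTriangular n) ⟩
      sumTo n (λ j → moments n j * columnStep (λ j → Q j k) j)
        ≈⟨ sumTo-cong n (λ j → *-congˡ (x·column j)) ⟨
      sumTo n (λ j → moments n j * shift (Q j) k)
        ≈⟨ shifted k ⟩
      δ (suc n) k ∎
      where
      x·column : ∀ j → shift (Q j) k ≈ columnStep (λ j → Q j k) j
      x·column zero    = trans (x·Q 0 k) (+-cong (sym (*-identityˡ _)) (+-congˡ (zeroʳ _)))
      x·column (suc j) = trans (x·Q (suc j) k) (+-congʳ (sym (*-identityˡ _)))
      shifted : ∀ k → sumTo n (λ j → moments n j * shift (Q j) k) ≈ δ (suc n) k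
      shifted zero    = sumTo-zero n (λ j _ → zeroʳ _)
      shifted (suc k) = moments·family n k

    family·moments-step : ∀ n k → (Q · moments) (suc n) k
      ≈ rowStep ((Q · moments) n) k
          - α n * (Q · moments) n k - β n * previous (Q · moments) n k
    family·moments-step n k = begin
      sumTo (suc n) (λ j → Q (suc n) j * moments j k)
        ≈⟨ sumTo-cong (suc n) (λ j → trans (*-congʳ (next n j)) (solve 6
             (λ s a q b p m → (s :- a :* q :- b :* p) :* m := s :* m :- a :* (q :* m) :- b :* (p :* m))
             refl (shift (Q n) j) (α n) (Q n j) (β n) (previous Q n j) (moments j k))) ⟩
      sumTo (suc n) (λ j → shift (Q n) j * moments j k - α n * (Q n j * moments j k)
                           - β n * (previous Q n j * moments j k))
        ≈⟨ trans (sumTo-+ (suc n) _ _) (+-cong (trans (sumTo-+ (suc n) _ _) (+-congˡ (scaled (α n) _)))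
                                               (scaled (β n) _)) ⟩
      sumTo (suc n) (λ j → shift (Q n) j * moments j k)
        - α n * sumTo (suc n) (λ j → Q n j * moments j k)
        - β n * sumTo (suc n) (λ j → previous Q n j * moments j k)
        ≈⟨ +-cong (+-cong shifted (-‿cong (*-congˡ (current n)))) (-‿cong (*-congˡ (preceding n))) ⟩
      rowStep ((Q · moments) n) k
        - α n * (Q · moments) n k - β n * previous (Q · moments) n k ∎
      where
      scaled : ∀ r f → sumTo (suc n) (λ j → - (r * f j)) ≈ - (r * sumTo (suc n) f)
      scaled r f = trans (sumTo-neg (suc n) _) (-‿cong (sumTo-*ˡ (suc n) r f))

      shifted : sumTo (suc n) (λ j → shift (Q n) j * moments j k)
                ≈ rowStep ((Q · moments) n) k
      shifted = trans (sumTo-head n _) (trans (+-congʳ (zeroˡ _)) (trans (+-identityˡ _)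
                  (sumTo-rowStep-linear n (Q n) moments k)))

      current : ∀ m → sumTo (suc m) (λ j → Q m j * moments j k) ≈ (Q · moments) m k
      current m = sumTo-extend (suc m) _ (ℕ.n≤1+n m)
        (λ j m<j → trans (*-congʳ (family-lowerTriangular m j m<j)) (zeroˡ _))

      preceding : ∀ n → sumTo (suc n) (λ j → previous Q n j * moments j k) ≈ previous (Q · moments) n k
      preceding zero    = sumTo-zero 1 (λ j _ → zeroˡ (moments j k))
      preceding (suc m) = trans (sumTo-extend (suc (suc m)) _ (ℕ.n≤1+n (suc m))
        (λ j 1+m<j → trans (*-congʳ (family-lowerTriangular m j (ℕ.<-trans (ℕ.n<1+n m) 1+m<j))) (zeroˡ _)))
        (current m)

    family·moments : ∀ n k → (Q · moments) n k ≈ δ n k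
    family·moments n = proj₁ (identity n)
      where
      identity : ∀ n → (Q · moments) n ≋ δ n × previous (Q · moments) n ≋ previous δ n
      identity zero    = (λ k → trans (*-congʳ (zeroth 0)) (*-identityˡ _)) , (λ _ → refl)
      identity (suc n) = (λ k → trans (family·moments-step n k) (trans (step k) (δ-step n k))) , Eₙ≋δₙ
        where
        Eₙ≋δₙ = proj₁ (identity n)
        step : ∀ k → rowStep ((Q · moments) n) k
                       - α n * (Q · moments) n k - β n * previous (Q · moments) n k
                     ≈ rowStep (δ n) k
                       - α n * δ n k - β n * previous δ n k
        step k = +-cong (+-cong (rowStep-cong Eₙ≋δₙ k)
                                (-‿cong (*-congˡ (Eₙ≋δₙ k))))
                        (-‿cong (*-congˡ (proj₂ (identity n) k)))

module QuadraticDenominators {a ℓ} (R : CommutativeRing a ℓ)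
  (p q : CommutativeRing.Carrier R) where

  open CommutativeRing R
  open RingDefs R
  open PowerSeries R
  open LowerTriangularMatrices R using (column; previous; shift-column)
  open IntegerRingSolver R using (solve; _:=_; con; _:+_; _:*_; :-_; _:-_)
  module S = IntegerRingSolver SeriesRing
  open SetoidReasoning setoid

  D : Series
  D = one ⊕ ((cst p ⊛ X) ⊕ (cst q ⊛ (X ⊛ X)))

  D⁻¹ : Series
  D⁻¹ = invQuad p q

  D-⊛ : ∀ h n → (D ⊛ h) n ≈ h n + (p * shift h n + q * shift (shift h) n)
  D-⊛ h n = begin
    (D ⊛ h) n
      ≈⟨ S.solve 4 (λ a b x h → (S.con (+ 1) S.:+ (a S.:* x S.:+ b S.:* (x S.:* x))) S.:* h
                              S.:= h S.:+ (a S.:* (x S.:* h) S.:+ b S.:* (x S.:* (x S.:* h))))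
               (λ _ → refl) (cst p) (cst q) X h n ⟩
    h n + ((cst p ⊛ (X ⊛ h)) n + (cst q ⊛ (X ⊛ (X ⊛ h))) n)
      ≈⟨ +-congˡ (+-cong (trans (cst-⊛ p (X ⊛ h) n) (*-congˡ (X-⊛ h n)))
                         (trans (cst-⊛ q (X ⊛ (X ⊛ h)) n)
                                (*-congˡ (trans (X-⊛ (X ⊛ h) n) (shift-cong (X-⊛ h) n))))) ⟩
    h n + (p * shift h n + q * shift (shift h) n) ∎

  D-⊛-D⁻¹ : (D ⊛ D⁻¹) ≋ one
  D-⊛-D⁻¹ n = trans (D-⊛ D⁻¹ n) (coefficient n)
    where
    coefficient : ∀ n → D⁻¹ n + (p * shift D⁻¹ n + q * shift (shift D⁻¹) n) ≈ one n
    coefficient zero = solve 2 (λ a b → con (+ 1) :+ (a :* con (+ 0) :+ b :* con (+ 0)) := con (+ 1)) refl p q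
    coefficient (suc zero) =
      solve 2 (λ a b → :- a :+ (a :* con (+ 1) :+ b :* con (+ 0)) := con (+ 0)) refl p q
    coefficient (suc (suc n)) = solve 4
      (λ a b x y → (:- (a :* x) :+ :- (b :* y)) :+ (a :* x :+ b :* y) := con (+ 0))
      refl p q (D⁻¹ (suc n)) (D⁻¹ n)

  module _ (g : Series) where

    riordanArray : Matrix
    riordanArray = riordan (g ⊛ D⁻¹) (X ⊛ D⁻¹)

    D-column : ℕ → Series
    D-column zero    = g
    D-column (suc k) = X ⊛ column riordanArray k

    D-⊛-column : ∀ k → (D ⊛ column riordanArray k) ≋ D-column k
    D-⊛-column zero n = begin
      (D ⊛ ((g ⊛ D⁻¹) ⊛ one)) n
        ≈⟨ S.solve 3 (λ d g e → d S.:* ((g S.:* e) S.:* S.con (+ 1)) S.:= (d S.:* e) S.:* g)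
                 (λ _ → refl) D g D⁻¹ n ⟩
      ((D ⊛ D⁻¹) ⊛ g) n
        ≈⟨ trans (⊛-congˡ g D-⊛-D⁻¹ n) (⊛-identityˡ g n) ⟩
      g n ∎
    D-⊛-column (suc k) n = begin
      (D ⊛ ((g ⊛ D⁻¹) ⊛ ((X ⊛ D⁻¹) ⊛ pow (X ⊛ D⁻¹) k))) n
        ≈⟨ S.solve 5 (λ d g e x f → d S.:* ((g S.:* e) S.:* ((x S.:* e) S.:* f))
                                 S.:= (d S.:* e) S.:* (x S.:* ((g S.:* e) S.:* f)))
                 (λ _ → refl) D g D⁻¹ X (pow (X ⊛ D⁻¹) k) n ⟩
      ((D ⊛ D⁻¹) ⊛ (X ⊛ column riordanArray k)) n
        ≈⟨ trans (⊛-congˡ (X ⊛ column riordanArray k) D-⊛-D⁻¹ n)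
                 (⊛-identityˡ (X ⊛ column riordanArray k) n) ⟩
      (X ⊛ column riordanArray k) n ∎

    riordanArray-entry : ∀ n k → riordanArray n k
      ≈ D-column k n - p * shift (column riordanArray k) n - q * shift (shift (column riordanArray k)) n
    riordanArray-entry n k = begin
      x
        ≈⟨ solve 5 (λ x a y b z → x := x :+ (a :* y :+ b :* z) :- a :* y :- b :* z) refl x p y q z ⟩
      x + (p * y + q * z) - p * y - q * z
        ≈⟨ +-congʳ (+-congʳ (trans (sym (D-⊛ (column riordanArray k) n)) (D-⊛-column k n))) ⟩
      D-column k n - p * y - q * z ∎
      where
      x = riordanArray n k
      y = shift (column riordanArray k) n
      z = shift (shift (column riordanArray k)) n

    riordanArray-row-zero : ∀ k → riordanArray 0 k ≈ cst (g 0) k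
    riordanArray-row-zero k = begin
      riordanArray 0 k                ≈⟨ riordanArray-entry 0 k ⟩
      D-column k 0 - p * 0# - q * 0#  ≈⟨ solve 3 (λ x a b → x :- a :* con (+ 0) :- b :* con (+ 0) := x)
                                                 refl (D-column k 0) p q ⟩
      D-column k 0                    ≈⟨ top k ⟩
      cst (g 0) k                     ∎
      where
      top : ∀ k → D-column k 0 ≈ cst (g 0) k
      top zero    = refl
      top (suc k) = X-⊛ (column riordanArray k) 0

    riordanArray-row-suc : ∀ n k → riordanArray (suc n) k
      ≈ (shift (riordanArray n) k + cst (g (suc n)) k) - p * riordanArray n k - q * previous riordanArray n k
    riordanArray-row-suc n k = trans (riordanArray-entry (suc n) k)
      (+-cong (+-congʳ (top k)) (-‿cong (*-congˡ (reflexive (shift-column riordanArray k n)))))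
      where
      top : ∀ k → D-column k (suc n) ≈ shift (riordanArray n) k + cst (g (suc n)) k
      top zero    = sym (+-identityˡ _)
      top (suc k) = trans (X-⊛ (column riordanArray k) (suc n)) (sym (+-identityʳ _))

module OtildePolynomials {a ℓ} (R : CommutativeRing a ℓ) (b c : CommutativeRing.Carrier R) where

  open CommutativeRing R
  open RingDefs R
  open PowerSeries R
  open LowerTriangularMatrices R
  open IntegerRingSolver R using (solve; _:=_; con; _:+_; _:*_; :-_; _:-_)

  α : ℕ → Carrier
  α zero    = b + c
  α (suc _) = (b + b) + c

  β : ℕ → Carrier
  β _ = b * (b + c)

  open ThreeTermRecurrences R α β public
  open QuadraticDenominators R (α 1) (β 0) using (riordanArray-row-zero; riordanArray-row-suc)

  Qt-family : IsThreeTermFamily (Qt b c)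
  Qt-family = record { zeroth = λ _ → refl ; next = next }
    where
    next : ∀ n k → Qt b c (suc n) k ≈ shift (Qt b c n) k - α n * Qt b c n k - β n * previous (Qt b c) n k
    next zero zero    = solve 3
      (λ b c d → con (+ 0) :+ :- (b :+ c) := con (+ 0) :- (b :+ c) :* con (+ 1) :- d :* con (+ 0))
      refl b c (β 0)
    next zero (suc k) = solve 3
      (λ x s d → x :+ con (+ 0) := x :- s :* con (+ 0) :- d :* con (+ 0))
      refl (δ 0 k) (b + c) (β 0)
    next (suc n) k = trans (+-cong (+-congˡ (cst-⊛ _ (Qt b c (suc n)) k)) (cst-⊛ _ (Qt b c n) k))
      (solve 5 (λ s a q d p → s :+ (:- a) :* q :+ (:- d) :* p := s :- a :* q :- d :* p)
         refl (shift (Qt b c (suc n)) k) (α (suc n)) (Qt b c (suc n) k) (β n) (Qt b c n k))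

  g : Series
  g = one ⊕ (cst b ⊛ X)

  g-suc : ∀ n → g (suc n) ≈ b * δ 0 n
  g-suc n = trans (+-identityˡ _) (cst-⊛ b X (suc n))

  Otilde-family : IsThreeTermFamily (Otilde b c)
  Otilde-family = record { zeroth = zeroth ; next = next }
    where
    open SetoidReasoning setoid

    zeroth : Otilde b c 0 ≋ δ 0
    zeroth zero    = trans (riordanArray-row-zero g 0)
                       (trans (+-congˡ (trans (cst-⊛ b X 0) (zeroʳ b))) (+-identityʳ 1#))
    zeroth (suc k) = riordanArray-row-zero g (suc k)

    cst-g-suc : ∀ n k → cst (g (suc n)) k ≈ b * δ 0 n * δ 0 k
    cst-g-suc n zero    = trans (g-suc n) (sym (*-identityʳ _))
    cst-g-suc n (suc k) = sym (zeroʳ _)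

    next : ∀ n k → Otilde b c (suc n) k
                   ≈ shift (Otilde b c n) k - α n * Otilde b c n k - β n * previous (Otilde b c) n k
    next zero k = begin
      Otilde b c 1 k
        ≈⟨ riordanArray-row-suc g 0 k ⟩
      shift (Otilde b c 0) k + cst (g 1) k - (b + b + c) * Otilde b c 0 k - β 0 * 0#
        ≈⟨ +-congʳ (+-cong (+-congˡ (cst-g-suc 0 k)) (-‿cong (*-congˡ (zeroth k)))) ⟩
      shift (Otilde b c 0) k + b * 1# * δ 0 k - (b + b + c) * δ 0 k - β 0 * 0#
        ≈⟨ solve 5 (λ s x b c d → s :+ b :* con (+ 1) :* x :- (b :+ b :+ c) :* x :- d :* con (+ 0)
                                := s :- (b :+ c) :* x :- d :* con (+ 0))
                 refl (shift (Otilde b c 0) k) (δ 0 k) b c (β 0) ⟩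
      shift (Otilde b c 0) k - (b + c) * δ 0 k - β 0 * 0#
        ≈⟨ +-congʳ (+-congˡ (-‿cong (*-congˡ (zeroth k)))) ⟨
      shift (Otilde b c 0) k - (b + c) * Otilde b c 0 k - β 0 * 0# ∎
    next (suc n) k = trans (riordanArray-row-suc g (suc n) k)
      (+-congʳ (+-congʳ (trans (+-congˡ (cst-g-suc (suc n) k))
        (trans (+-congˡ (trans (*-congʳ (zeroʳ b)) (zeroˡ _))) (+-identityʳ _)))))

  Otilde≈Qt : ∀ n k → Otilde b c n k ≈ Qt b c n k
  Otilde≈Qt = family-unique Otilde-family Qt-family

  Otilde-inverse : IsInverse (Otilde b c) moments
  Otilde-inverse = family·moments Otilde-family , moments·family Otilde-family

module OtildeMoments {a ℓ} (R : CommutativeRing a ℓ) (b c : CommutativeRing.Carrier R) where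

  open CommutativeRing R
  open RingDefs R
  open PowerSeries R
  open LowerTriangularMatrices R
  open IntegerRingSolver R using (solve; _:=_; con; _:+_; _:*_)
  module S = IntegerRingSolver SeriesRing
  open import Algebra.Properties.Semiring.Exp semiring using (_^_)
  open OtildePolynomials R b c
  open ProductionMatrices R (λ _ → b + c) α (λ _ → b)

  module SR = CommutativeRing SeriesRing
  module ≋-Reasoning = SetoidReasoning SR.setoid

  Φ : Series → Series
  Φ u = one ⊕ (X ⊛ ((cst c ⊛ u) ⊕ (cst b ⊛ (u ⊛ u))))

  Φ-contraction : IsContraction Φ
  Φ-contraction u≈v = ⊕-cong-< (λ _ _ → refl) (X-⊛-cong-<
    (⊕-cong-< (⊛-cong-< (λ _ _ → refl) u≈v) (⊛-cong-< (λ _ _ → refl) (⊛-cong-< u≈v u≈v))))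

  μ : Series
  μ = FixedPoint.fixedPoint Φ Φ-contraction

  μ-fixed : Φ μ ≋ μ
  μ-fixed = FixedPoint.fixedPoint-fixed Φ Φ-contraction

  μ-isMuTilde : IsMuTilde b c μ
  μ-isMuTilde = begin
    μ ⊛ ((one ⊕ (cst (- c) ⊛ X)) ⊕ (cst (- b) ⊛ (X ⊛ μ)))
      ≈⟨ ⊛-congʳ μ (SR.+-cong (⊕-congˡ one (⊛-congˡ X (cst-neg c)))
                              (⊛-congˡ (X ⊛ μ) (cst-neg b))) ⟩
    μ ⊛ ((one ⊕ (neg (cst c) ⊛ X)) ⊕ (neg (cst b) ⊛ (X ⊛ μ)))
      ≈⟨ S.solve 4 (λ μ x c b → μ S.:* ((S.con (+ 1) S.:+ (S.:- c) S.:* x) S.:+ (S.:- b) S.:* (x S.:* μ))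
                             S.:= μ S.:- x S.:* (c S.:* μ S.:+ b S.:* (μ S.:* μ)))
               (λ _ → refl) μ X (cst c) (cst b) ⟩
    μ ⊕ neg T
      ≈⟨ ⊕-congʳ (neg T) μ-fixed ⟨
    Φ μ ⊕ neg T
      ≈⟨ S.solve 2 (λ o t → (o S.:+ t) S.:- t S.:= o) (λ _ → refl) one T ⟩
    one ∎
    where
    open ≋-Reasoning
    T = X ⊛ ((cst c ⊛ μ) ⊕ (cst b ⊛ (μ ⊛ μ)))

  -- m = μ - 1, written without subtraction.
  m : Series
  m = X ⊛ (μ ⊛ (cst c ⊕ (cst b ⊛ μ)))

  μ≋1+m : μ ≋ (one ⊕ m)
  μ≋1+m = begin
    μ      ≈⟨ μ-fixed ⟨
    Φ μ    ≈⟨ S.solve 4 (λ μ x c b → S.con (+ 1) S.:+ x S.:* (c S.:* μ S.:+ b S.:* (μ S.:* μ))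
                                  S.:= S.con (+ 1) S.:+ x S.:* (μ S.:* (c S.:+ b S.:* μ)))
                      (λ _ → refl) μ X (cst c) (cst b) ⟩
    one ⊕ m ∎
    where open ≋-Reasoning

  m-fixed : m ≋ (X ⊛ ((cst (b + c) ⊕ (cst ((b + b) + c) ⊛ m)) ⊕ (cst b ⊛ (m ⊛ m))))
  m-fixed = begin
    X ⊛ (μ ⊛ (cst c ⊕ (cst b ⊛ μ)))
      ≈⟨ ⊛-congʳ X (⊛-cong μ≋1+m (⊕-congˡ (cst c) (⊛-congʳ (cst b) μ≋1+m))) ⟩
    X ⊛ ((one ⊕ m) ⊛ (cst c ⊕ (cst b ⊛ (one ⊕ m))))
      ≈⟨ S.solve 4 (λ x m c b → x S.:* ((S.con (+ 1) S.:+ m) S.:* (c S.:+ b S.:* (S.con (+ 1) S.:+ m)))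
                             S.:= x S.:* (((b S.:+ c) S.:+ ((b S.:+ b) S.:+ c) S.:* m) S.:+ b S.:* (m S.:* m)))
               (λ _ → refl) X m (cst c) (cst b) ⟩
    X ⊛ (((cst b ⊕ cst c) ⊕ (((cst b ⊕ cst b) ⊕ cst c) ⊛ m)) ⊕ (cst b ⊛ (m ⊛ m)))
      ≈⟨ ⊛-congʳ X (⊕-congʳ (cst b ⊛ (m ⊛ m))
                             (SR.+-cong (SR.sym (cst-+ b c)) (⊛-congˡ m (SR.sym α-cst)))) ⟩
    X ⊛ ((cst (b + c) ⊕ (cst ((b + b) + c) ⊛ m)) ⊕ (cst b ⊛ (m ⊛ m))) ∎
    where
    open ≋-Reasoning
    α-cst : cst ((b + b) + c) ≋ ((cst b ⊕ cst b) ⊕ cst c)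
    α-cst = SR.trans (cst-+ (b + b) c) (⊕-congʳ (cst c) (cst-+ b b))

  columns : ℕ → Series
  columns k = μ ⊛ pow m k

  -- Column k of the row (columns 0, columns 1, …) times tridiag(b + c, α, b).
  columns·P : ℕ → Series
  columns·P zero    = (cst (b + c) ⊛ columns 0) ⊕ (cst b ⊛ columns 1)
  columns·P (suc k) =
    (cst (b + c) ⊛ columns k) ⊕ ((cst ((b + b) + c) ⊛ columns (suc k)) ⊕ (cst b ⊛ columns (suc (suc k))))

  columns-zero : columns 0 ≋ (one ⊕ (X ⊛ columns·P 0))
  columns-zero = begin
    μ ⊛ one
      ≈⟨ SR.*-identityʳ μ ⟩
    μ
      ≈⟨ μ≋1+m ⟩
    one ⊕ (X ⊛ (μ ⊛ (cst c ⊕ (cst b ⊛ μ))))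
      ≈⟨ ⊕-congˡ one (⊛-congʳ X (⊛-congʳ μ (⊕-congˡ (cst c) (⊛-congʳ (cst b) μ≋1+m)))) ⟩
    one ⊕ (X ⊛ (μ ⊛ (cst c ⊕ (cst b ⊛ (one ⊕ m)))))
      ≈⟨ S.solve 5 (λ x μ m c b → S.con (+ 1) S.:+ x S.:* (μ S.:* (c S.:+ b S.:* (S.con (+ 1) S.:+ m)))
                               S.:= S.con (+ 1) S.:+ x S.:* ((b S.:+ c) S.:* (μ S.:* S.con (+ 1))
                                                           S.:+ b S.:* (μ S.:* (m S.:* S.con (+ 1)))))
               (λ _ → refl) X μ m (cst c) (cst b) ⟩
    one ⊕ (X ⊛ (((cst b ⊕ cst c) ⊛ columns 0) ⊕ (cst b ⊛ columns 1)))
      ≈⟨ ⊕-congˡ one (⊛-congʳ X (⊕-congʳ (cst b ⊛ columns 1)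
                                           (⊛-congˡ (columns 0) (SR.sym (cst-+ b c))))) ⟩
    one ⊕ (X ⊛ columns·P 0) ∎
    where open ≋-Reasoning

  columns-suc : ∀ k → columns (suc k) ≋ (X ⊛ columns·P (suc k))
  columns-suc k = begin
    μ ⊛ (m ⊛ pow m k)
      ≈⟨ S.solve 3 (λ μ m p → μ S.:* (m S.:* p) S.:= m S.:* (μ S.:* p)) (λ _ → refl) μ m (pow m k) ⟩
    m ⊛ columns k
      ≈⟨ ⊛-congˡ (columns k) m-fixed ⟩
    (X ⊛ ((cst (b + c) ⊕ (cst ((b + b) + c) ⊛ m)) ⊕ (cst b ⊛ (m ⊛ m)))) ⊛ columns k
      ≈⟨ S.solve 6 (λ x s a b m q → (x S.:* ((s S.:+ a S.:* m) S.:+ b S.:* (m S.:* m))) S.:* q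
                                 S.:= x S.:* (s S.:* q S.:+ (a S.:* (m S.:* q) S.:+ b S.:* (m S.:* (m S.:* q)))))
               (λ _ → refl) X (cst (b + c)) (cst ((b + b) + c)) (cst b) m (columns k) ⟩
    X ⊛ ((cst (b + c) ⊛ columns k)
          ⊕ ((cst ((b + b) + c) ⊛ (m ⊛ columns k)) ⊕ (cst b ⊛ (m ⊛ (m ⊛ columns k)))))
      ≈⟨ ⊛-congʳ X (⊕-congˡ (cst (b + c) ⊛ columns k)
           (SR.+-cong (⊛-congʳ (cst ((b + b) + c)) (m⊛columns k))
                      (⊛-congʳ (cst b) (SR.trans (⊛-congʳ m (m⊛columns k)) (m⊛columns (suc k)))))) ⟩
    X ⊛ columns·P (suc k) ∎
    where
    open ≋-Reasoning
    m⊛columns : ∀ k → (m ⊛ columns k) ≋ columns (suc k)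
    m⊛columns k =
      S.solve 3 (λ m μ p → m S.:* (μ S.:* p) S.:= μ S.:* (m S.:* p)) (λ _ → refl) m μ (pow m k)

  columns≈productionArray : ∀ n k → columns k n ≈ productionArray n k
  columns≈productionArray = productionArray-unique first rest
    where
    first : (λ k → columns k 0) ≋ δ 0
    first zero    = trans (columns-zero 0) (trans (+-congˡ (X-⊛ (columns·P 0) 0)) (+-identityʳ 1#))
    first (suc k) = trans (columns-suc k 0) (X-⊛ (columns·P (suc k)) 0)

    rest : ∀ n → (λ k → columns k (suc n)) ≋ rowStep (λ k → columns k n)
    rest n zero = begin
      columns 0 (suc n)
        ≈⟨ trans (columns-zero (suc n)) (trans (+-identityˡ _) (X-⊛ (columns·P 0) (suc n))) ⟩
      (cst (b + c) ⊛ columns 0) n + (cst b ⊛ columns 1) n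
        ≈⟨ +-cong (cst-⊛ (b + c) (columns 0) n) (cst-⊛ b (columns 1) n) ⟩
      (b + c) * columns 0 n + b * columns 1 n
        ≈⟨ +-identityˡ _ ⟨
      0# + ((b + c) * columns 0 n + b * columns 1 n)
        ≈⟨ +-congʳ (zeroʳ (b + c)) ⟨
      (b + c) * 0# + ((b + c) * columns 0 n + b * columns 1 n) ∎
      where open SetoidReasoning setoid
    rest n (suc k) = trans (columns-suc k (suc n)) (trans (X-⊛ (columns·P (suc k)) (suc n))
      (+-cong (cst-⊛ (b + c) (columns k) n)
              (+-cong (cst-⊛ ((b + b) + c) (columns (suc k)) n) (cst-⊛ b (columns (suc (suc k))) n))))

  scaledMoments≈productionArray : ∀ n k → (b + c) ^ k * moments n k ≈ productionArray n k
  scaledMoments≈productionArray = productionArray-unique first rest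
    where
    first : (λ k → (b + c) ^ k * δ 0 k) ≋ δ 0
    first zero    = *-identityˡ 1#
    first (suc k) = zeroʳ _

    rest : ∀ n → (λ k → (b + c) ^ k * moments (suc n) k)
                 ≋ rowStep (λ k → (b + c) ^ k * moments n k)
    rest n zero = solve 4
      (λ b c x y → con (+ 1) :* (con (+ 1) :* con (+ 0) :+ ((b :+ c) :* x :+ (b :* (b :+ c)) :* y))
                := (b :+ c) :* con (+ 0) :+ ((b :+ c) :* (con (+ 1) :* x) :+ b :* (((b :+ c) :* con (+ 1)) :* y)))
      refl b c (moments n 0) (moments n 1)
    rest n (suc k) = solve 6
      (λ b c p x y z → ((b :+ c) :* p) :* (con (+ 1) :* x :+ ((b :+ b :+ c) :* y :+ (b :* (b :+ c)) :* z))
                    := (b :+ c) :* (p :* x) :+ ((b :+ b :+ c) :* (((b :+ c) :* p) :* y)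
                                               :+ b :* (((b :+ c) :* ((b :+ c) :* p)) :* z)))
      refl b c ((b + c) ^ k) (moments n k) (moments n (suc k)) (moments n (suc (suc k)))

  moments-column₀ : ∀ n → moments n 0 ≈ μ n
  moments-column₀ n = begin
    moments n 0           ≈⟨ *-identityˡ _ ⟨
    1# * moments n 0      ≈⟨ scaledMoments≈productionArray n 0 ⟩
    productionArray n 0   ≈⟨ columns≈productionArray n 0 ⟨
    (μ ⊛ one) n           ≈⟨ SR.*-identityʳ μ n ⟩
    μ n                   ∎
    where open SetoidReasoning setoid

  IsMuTilde-cong : ∀ {s s′} → s ≋ s′ → IsMuTilde b c s → IsMuTilde b c s′
  IsMuTilde-cong {s} {s′} s≋s′ isMuTilde = SR.trans
    (SR.sym (⊛-cong s≋s′ (⊕-congˡ (one ⊕ (cst (- c) ⊛ X))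
                                  (⊛-congʳ (cst (- b)) (⊛-congʳ X s≋s′)))))
    isMuTilde

  inverse-column₀ : ∀ {P} → IsInverse (Otilde b c) P → column₀ P ≋ μ
  inverse-column₀ P-inverse n = trans
    (inverse-unique (family-lowerTriangular Otilde-family) moments-lowerTriangular Otilde-inverse P-inverse n 0)
    (moments-column₀ n)

mainTheorem9 : ∀ {a ℓ} (R : CommutativeRing a ℓ) →
    let open CommutativeRing R in
    let open RingDefs R in (b c : Carrier) → ¬ (b ≈ 0#) → ¬ (c ≈ 0#) →
    ((∀ n k → Otilde b c n k ≈ Qt b c n k)
    × (Σ Matrix λ P → LowerTriangular P × IsInverse (Otilde b c) P))
    × (∀ P → LowerTriangular P → IsInverse (Otilde b c) P →
    IsMuTilde b c (column₀ P))
mainTheorem9 R b c _ _ =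
    (Otilde≈Qt , moments , moments-lowerTriangular , Otilde-inverse)
  , λ P _ P-inverse → IsMuTilde-cong (λ n → sym (inverse-column₀ P-inverse n)) μ-isMuTilde
  where
  open CommutativeRing R using (sym)
  open OtildePolynomials R b c using (Otilde≈Qt; Otilde-inverse; moments; moments-lowerTriangular)
  open OtildeMoments R b c using (μ-isMuTilde; IsMuTilde-cong; inverse-column₀)
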